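{- Let $p\geq 3$ be prime. Let $F_{p-1}(q)=\prod_{j\geq 1}\frac{1}{(1-q^j)(1-q^{2j})^{p-2}}$ and $\psi(q)=\sum_{k\geq 0} q^{k(k+1)/2}$. Then, as formal power series in $q$, $$F_{p-1}(q)=\psi(q)\prod_{i\geq 1}\psi\!\left(q^{2^i}\right)^{p\cdot 2^{i-1}}.$$
   Context: $\psi(q)$ is Ramanujan's theta function, which also equals $\prod_{j\geq1}\frac{(1-q^{2j})^2}{1-q^j}$. -}

module Defs where

open import Data.Nat using (ℕ; zero; suc; _+_; _*_; _∸_; _^_; _≡ᵇ_; _/_)
open import Data.Bool using (if_then_else_)

-- Formal power series in q with natural-number coefficients:
-- a series is its coefficient function, f n = [q^n] f.
Series : Set
Series = ℕ → ℕ

sumTo : ℕ → (ℕ → ℕ) → ℕ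
sumTo zero    f = f 0
sumTo (suc n) f = sumTo n f + f (suc n)

ind : ℕ → ℕ → ℕ
ind a b = if a ≡ᵇ b then 1 else 0

oneS : Series
oneS n = ind n 0

_⊛_ : Series → Series → Series
(f ⊛ g) n = sumTo n (λ k → f k * g (n ∸ k))

infixl 7 _⊛_

powS : Series → ℕ → Series
powS f zero    = oneS
powS f (suc e) = f ⊛ powS f e

-- substitution q ↦ q^m (for m ≥ 1):  [q^n] f(q^m) = Σ_{k : k*m = n} [q^k] f
subQ : ℕ → Series → Series
subQ m f n = sumTo n (λ k → ind (k * m) n * f k)

prodTo : ℕ → (ℕ → Series) → Series
prodTo zero    F = oneS
prodTo (suc N) F = prodTo N F ⊛ F (suc N)

-- infinite product ∏_{i ≥ 1} F i, for factors with F i ≡ 1 (mod q^{i}):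
-- the coefficient of q^n is that of the finite product over i = 1..n.
infProd : (ℕ → Series) → Series
infProd F n = prodTo n F n

-- geometric series 1/(1-q) = Σ_{k ≥ 0} q^k
geomS : Series
geomS n = 1

-- ψ(q) = Σ_{k ≥ 0} q^{k(k+1)/2}  (terms with k > n cannot contribute to q^n)
psiS : Series
psiS n = sumTo n (λ k → ind ((k * suc k) / 2) n)

Fser : ℕ → Series
Fser p = infProd (λ j → subQ j geomS ⊛ powS (subQ (2 * j) geomS) (p ∸ 2))

RHSser : ℕ → Series
RHSser p = psiS ⊛ infProd (λ i → powS (subQ (2 ^ i) psiS) (p * 2 ^ (i ∸ 1)))

-- Euler's identity (-q; q)∞ (q; q)∞ = (q²; q²)∞ and Gauss's identity (-q; q)∞² (q; q)∞ = ψ(q)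
-- combine into P(q) = ψ(q) P(q²)², where P = 1/(q; q)∞ is the partition generating function.
-- Since F_{p-1}(q) = P(q) P(q²)^{p-2} = ψ(q) P(q²)^p, iterating P(q^m) = ψ(q^m) P(q^{2m})²
-- along m = 2, 4, 8, ... produces the product of the ψ(q^{2^i}); after M steps the leftover
-- power of P(q^{2^{M+1}}) is 1 modulo q^{2^{M+1}}.
-- Gauss's identity is the limit of the finite triple product identity
--   Σ_{i=0}^{2n+1} q^{(i-n)(i-n-1)/2} [2n+1, i] = 2 (-q; q)_n²,
-- proved by induction on n with the two Pascal rules for Gaussian binomials: in degrees ≤ n the
-- terms q^{(i-n)(i-n-1)/2} [2n+1, i] only involve coefficients where [2n+1, i] agrees with P.

module Submission where

open import Data.Nat using (ℕ; _≤_)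
open import Data.Nat.Primality using (Prime)
open import Relation.Binary.PropositionalEquality using (_≡_)
open import Defs

open import Algebra.Bundles using (CommutativeSemiring)
open import Data.Empty using (⊥-elim)
open import Data.Nat using (zero; suc; _+_; _*_; _∸_; _^_; _<_; z≤n; s≤s; _/_; NonZero)
open import Data.Nat.Divisibility using (_∣_; divides; _∣?_; ∣m+n∣m⇒∣n; ∣⇒≤; ∣m∸n∣n⇒∣m; n∣m*n)
open import Data.Nat.DivMod using (m*n/n≡m)
open import Data.Nat.Properties
open import Data.Nat.Tactic.RingSolver using (solve-∀)
open import Data.Sum using (inj₁; inj₂)
open import Function using (_∘_)
open import Level using (0ℓ)
open import Relation.Binary.Definitions using (tri<; tri≈; tri>)
open import Relation.Binary.PropositionalEquality
  using (_≢_; refl; sym; trans; cong; cong₂; subst; _≗_; module ≡-Reasoning)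
import Relation.Binary.Reasoning.Setoid
open import Relation.Binary.Structures using (IsEquivalence)
open import Relation.Nullary using (¬_; yes; no)
open import Algebra.Structures {A = Series} _≗_ using (IsSemigroup)
open import Algebra.Structures.Biased {A = Series} _≗_
  using (IsCommutativeSemiringˡ; isCommutativeMonoidˡ)
open import Algebra.Properties.CommutativeSemigroup +-commutativeSemigroup
  using () renaming (interchange to +-interchange; x∙yz≈y∙xz to x+[y+z]≡y+[x+z])

sumTo-cong : ∀ n {f g : ℕ → ℕ} → (∀ k → k ≤ n → f k ≡ g k) → sumTo n f ≡ sumTo n g
sumTo-cong zero    f≡g = f≡g 0 z≤n
sumTo-cong (suc n) f≡g =
  cong₂ _+_ (sumTo-cong n (λ k k≤n → f≡g k (m≤n⇒m≤1+n k≤n))) (f≡g (suc n) ≤-refl)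

sumTo-+ : ∀ n (f g : ℕ → ℕ) → sumTo n (λ k → f k + g k) ≡ sumTo n f + sumTo n g
sumTo-+ zero    f g = refl
sumTo-+ (suc n) f g =
  trans (cong (_+ (f (suc n) + g (suc n))) (sumTo-+ n f g)) (+-interchange (sumTo n f) (sumTo n g) _ _)

sumTo-*ˡ : ∀ n c (f : ℕ → ℕ) → sumTo n (λ k → c * f k) ≡ c * sumTo n f
sumTo-*ˡ zero    c f = refl
sumTo-*ˡ (suc n) c f =
  trans (cong (_+ c * f (suc n)) (sumTo-*ˡ n c f)) (sym (*-distribˡ-+ c (sumTo n f) (f (suc n))))

sumTo-*ʳ : ∀ n c (f : ℕ → ℕ) → sumTo n (λ k → f k * c) ≡ sumTo n f * c
sumTo-*ʳ n c f =
  trans (sumTo-cong n (λ k _ → *-comm (f k) c)) (trans (sumTo-*ˡ n c f) (*-comm c (sumTo n f)))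

sumTo-zero : ∀ n (f : ℕ → ℕ) → (∀ k → k ≤ n → f k ≡ 0) → sumTo n f ≡ 0
sumTo-zero zero    f f≡0 = f≡0 0 z≤n
sumTo-zero (suc n) f f≡0 =
  cong₂ _+_ (sumTo-zero n f (λ k k≤n → f≡0 k (m≤n⇒m≤1+n k≤n))) (f≡0 (suc n) ≤-refl)

sumTo-sucˡ : ∀ n (f : ℕ → ℕ) → sumTo (suc n) f ≡ f 0 + sumTo n (λ k → f (suc k))
sumTo-sucˡ zero    f = refl
sumTo-sucˡ (suc n) f = trans (cong (_+ f (suc (suc n))) (sumTo-sucˡ n f)) (+-assoc (f 0) _ _)

sumTo-reverse : ∀ n (f : ℕ → ℕ) → sumTo n f ≡ sumTo n (λ k → f (n ∸ k))
sumTo-reverse zero    f = refl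
sumTo-reverse (suc n) f = begin
  sumTo n f + f (suc n)                       ≡⟨ cong (_+ f (suc n)) (sumTo-reverse n f) ⟩
  sumTo n (λ k → f (n ∸ k)) + f (suc n)       ≡⟨ +-comm _ (f (suc n)) ⟩
  f (suc n) + sumTo n (λ k → f (n ∸ k))       ≡⟨ sumTo-sucˡ n (λ k → f (suc n ∸ k)) ⟨
  sumTo (suc n) (λ k → f (suc n ∸ k))         ∎
  where open ≡-Reasoning

sumTo-split : ∀ a b (f : ℕ → ℕ) →
              sumTo (a + suc b) f ≡ sumTo a f + sumTo b (λ r → f (a + suc r))
sumTo-split a zero    f rewrite +-comm a 1 = refl
sumTo-split a (suc b) f rewrite +-suc a (suc b) | sumTo-split a b f = +-assoc (sumTo a f) _ _

sumTo-extend : ∀ m d (f : ℕ → ℕ) → (∀ k → m < k → k ≤ m + d → f k ≡ 0) →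
               sumTo (m + d) f ≡ sumTo m f
sumTo-extend m zero    f f≡0 rewrite +-identityʳ m = refl
sumTo-extend m (suc d) f f≡0 rewrite +-suc m d =
  trans (cong₂ _+_ (sumTo-extend m d f (λ k m<k k≤ → f≡0 k m<k (m≤n⇒m≤1+n k≤)))
                   (f≡0 (suc (m + d)) (s≤s (m≤m+n m d)) ≤-refl))
        (+-identityʳ _)

sumTo-single : ∀ n j (f : ℕ → ℕ) → j ≤ n → (∀ k → k ≤ n → k ≢ j → f k ≡ 0) →
               sumTo n f ≡ f j
sumTo-single zero    zero f z≤n f≡0 = refl
sumTo-single (suc n) j    f j≤n f≡0 with j ≟ suc n
... | yes refl =
  cong (_+ f (suc n)) (sumTo-zero n f (λ k k≤n → f≡0 k (m≤n⇒m≤1+n k≤n) (<⇒≢ (s≤s k≤n))))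
... | no j≢ =
  trans (cong₂ _+_ (sumTo-single n j f (≤-pred (≤∧≢⇒< j≤n j≢))
                                 (λ k k≤n → f≡0 k (m≤n⇒m≤1+n k≤n)))
                   (f≡0 (suc n) ≤-refl (j≢ ∘ sym)))
        (+-identityʳ _)

sumTo-comm : ∀ m n (A : ℕ → ℕ → ℕ) →
             sumTo m (λ k → sumTo n (λ i → A i k)) ≡ sumTo n (λ i → sumTo m (A i))
sumTo-comm zero    n A = refl
sumTo-comm (suc m) n A =
  trans (cong (_+ sumTo n (λ i → A i (suc m))) (sumTo-comm m n A))
        (sym (sumTo-+ n (λ i → sumTo m (A i)) (λ i → A i (suc m))))

sumTo-triangle : ∀ n (A : ℕ → ℕ → ℕ) →
  sumTo n (λ i → sumTo i (λ j → A j i)) ≡ sumTo n (λ j → sumTo (n ∸ j) (λ l → A j (j + l)))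
sumTo-triangle zero    A = refl
sumTo-triangle (suc n) A = begin
  sumTo n (λ i → sumTo i (λ j → A j i)) + sumTo (suc n) (λ j → A j (suc n))
    ≡⟨ cong (_+ sumTo (suc n) (λ j → A j (suc n))) (sumTo-triangle n A) ⟩
  sumTo n row + (sumTo n (λ j → A j (suc n)) + A (suc n) (suc n))
    ≡⟨ +-assoc (sumTo n row) _ _ ⟨
  sumTo n row + sumTo n (λ j → A j (suc n)) + A (suc n) (suc n)
    ≡⟨ cong₂ _+_ (sym (sumTo-+ n row (λ j → A j (suc n)))) (cong (A (suc n)) (sym (+-identityʳ (suc n)))) ⟩
  sumTo n (λ j → row j + A j (suc n)) + A (suc n) (suc n + 0)
    ≡⟨ cong₂ _+_ (sumTo-cong n longerRow) (cong (λ t → sumTo t (λ l → A (suc n) (suc n + l))) (n∸n≡0 n)) ⟨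
  sumTo (suc n) (λ j → sumTo (suc n ∸ j) (λ l → A j (j + l)))
    ∎
  where
  open ≡-Reasoning
  row : ℕ → ℕ
  row j = sumTo (n ∸ j) (λ l → A j (j + l))
  longerRow : ∀ j → j ≤ n → sumTo (suc n ∸ j) (λ l → A j (j + l)) ≡ row j + A j (suc n)
  longerRow j j≤n rewrite +-∸-assoc 1 j≤n =
    cong (row j +_) (cong (A j) (trans (+-suc j (n ∸ j)) (cong suc (m+[n∸m]≡n j≤n))))

ind-refl : ∀ a → ind a a ≡ 1
ind-refl zero    = refl
ind-refl (suc a) = ind-refl a

ind-≢ : ∀ a b → a ≢ b → ind a b ≡ 0
ind-≢ zero    zero    a≢b = ⊥-elim (a≢b refl)
ind-≢ zero    (suc b) a≢b = refl
ind-≢ (suc a) zero    a≢b = refl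
ind-≢ (suc a) (suc b) a≢b = ind-≢ a b (λ a≡b → a≢b (cong suc a≡b))

ind-sym : ∀ a b → ind a b ≡ ind b a
ind-sym zero    zero    = refl
ind-sym zero    (suc b) = refl
ind-sym (suc a) zero    = refl
ind-sym (suc a) (suc b) = ind-sym a b

infixl 6 _⊕_
_⊕_ : Series → Series → Series
(f ⊕ g) n = f n + g n

zeroS : Series
zeroS _ = 0

infix 4 _≗[≤_]_
_≗[≤_]_ : Series → ℕ → Series → Set
f ≗[≤ d ] g = ∀ k → k ≤ d → f k ≡ g k

≗⇒≗[≤] : ∀ d {f g} → f ≗ g → f ≗[≤ d ] g
≗⇒≗[≤] d f≗g k _ = f≗g k

≗[≤]-sym : ∀ d {f g} → f ≗[≤ d ] g → g ≗[≤ d ] f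
≗[≤]-sym d f≈g k k≤d = sym (f≈g k k≤d)

≗[≤]-trans : ∀ d {f g h} → f ≗[≤ d ] g → g ≗[≤ d ] h → f ≗[≤ d ] h
≗[≤]-trans d f≈g g≈h k k≤d = trans (f≈g k k≤d) (g≈h k k≤d)

≗[≤]⇒≗ : ∀ {f g} → (∀ d → f ≗[≤ d ] g) → f ≗ g
≗[≤]⇒≗ f≈g d = f≈g d d ≤-refl

⊛-cong-≤ : ∀ d {f f′ g g′} → f ≗[≤ d ] f′ → g ≗[≤ d ] g′ → f ⊛ g ≗[≤ d ] f′ ⊛ g′
⊛-cong-≤ d f≈f′ g≈g′ k k≤d = sumTo-cong k λ j j≤k →
  cong₂ _*_ (f≈f′ j (≤-trans j≤k k≤d)) (g≈g′ (k ∸ j) (≤-trans (m∸n≤m k j) k≤d))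

⊛-cong : ∀ {f f′ g g′} → f ≗ f′ → g ≗ g′ → f ⊛ g ≗ f′ ⊛ g′
⊛-cong f≗f′ g≗g′ n = ⊛-cong-≤ n (λ k _ → f≗f′ k) (λ k _ → g≗g′ k) n ≤-refl

⊛-comm : ∀ f g → f ⊛ g ≗ g ⊛ f
⊛-comm f g n = trans (sumTo-reverse n _) (sumTo-cong n λ k k≤n →
  trans (*-comm (f (n ∸ k)) _) (cong (λ t → g t * f (n ∸ k)) (m∸[m∸n]≡n k≤n)))

⊛-assoc : ∀ f g h → (f ⊛ g) ⊛ h ≗ f ⊛ (g ⊛ h)
⊛-assoc f g h n = begin
  sumTo n (λ i → sumTo i (λ j → f j * g (i ∸ j)) * h (n ∸ i))
    ≡⟨ sumTo-cong n (λ i _ → sym (sumTo-*ʳ i (h (n ∸ i)) (λ j → f j * g (i ∸ j)))) ⟩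
  sumTo n (λ i → sumTo i (λ j → f j * g (i ∸ j) * h (n ∸ i)))
    ≡⟨ sumTo-triangle n (λ j i → f j * g (i ∸ j) * h (n ∸ i)) ⟩
  sumTo n (λ j → sumTo (n ∸ j) (λ l → f j * g (j + l ∸ j) * h (n ∸ (j + l))))
    ≡⟨ sumTo-cong n (λ j _ → sumTo-cong (n ∸ j) (λ l _ → reindex j l)) ⟩
  sumTo n (λ j → sumTo (n ∸ j) (λ l → f j * (g l * h (n ∸ j ∸ l))))
    ≡⟨ sumTo-cong n (λ j _ → sumTo-*ˡ (n ∸ j) (f j) (λ l → g l * h (n ∸ j ∸ l))) ⟩
  sumTo n (λ j → f j * sumTo (n ∸ j) (λ l → g l * h (n ∸ j ∸ l)))
    ∎
  where
  open ≡-Reasoning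
  reindex : ∀ j l → f j * g (j + l ∸ j) * h (n ∸ (j + l)) ≡ f j * (g l * h (n ∸ j ∸ l))
  reindex j l = trans (*-assoc (f j) _ _)
    (cong₂ (λ a b → f j * (g a * h b)) (m+n∸m≡n j l) (sym (∸-+-assoc n j l)))

⊛-identityˡ : ∀ f → oneS ⊛ f ≗ f
⊛-identityˡ f n = trans (sumTo-single n 0 _ z≤n λ where
                           zero    _ 0≢0 → ⊥-elim (0≢0 refl)
                           (suc k) _ _   → refl)
                        (+-identityʳ (f n))

⊛-zeroˡ : ∀ f → zeroS ⊛ f ≗ zeroS
⊛-zeroˡ f n = sumTo-zero n _ (λ _ _ → refl)

⊛-distribʳ : ∀ h f g → (f ⊕ g) ⊛ h ≗ f ⊛ h ⊕ g ⊛ h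
⊛-distribʳ h f g n =
  trans (sumTo-cong n (λ k _ → *-distribʳ-+ (h (n ∸ k)) (f k) (g k))) (sumTo-+ n _ _)

≗-isEquivalence : IsEquivalence (_≗_ {A = ℕ} {B = ℕ})
≗-isEquivalence = record
  { refl  = λ _ → refl
  ; sym   = λ f≗g n → sym (f≗g n)
  ; trans = λ f≗g g≗h n → trans (f≗g n) (g≗h n)
  }

seriesSemiring : CommutativeSemiring 0ℓ 0ℓ
seriesSemiring = record
  { _+_ = _⊕_
  ; _*_ = _⊛_
  ; 0#  = zeroS
  ; 1#  = oneS
  ; isCommutativeSemiring = IsCommutativeSemiringˡ.isCommutativeSemiring record
    { +-isCommutativeMonoid = isCommutativeMonoidˡ record
      { isSemigroup = semigroup _⊕_ (λ f≗ g≗ n → cong₂ _+_ (f≗ n) (g≗ n))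
                                    (λ f g h n → +-assoc (f n) (g n) (h n))
      ; identityˡ   = λ f n → refl
      ; comm        = λ f g n → +-comm (f n) (g n)
      }
    ; *-isCommutativeMonoid = isCommutativeMonoidˡ record
      { isSemigroup = semigroup _⊛_ ⊛-cong ⊛-assoc
      ; identityˡ   = ⊛-identityˡ
      ; comm        = ⊛-comm
      }
    ; distribʳ = ⊛-distribʳ
    ; zeroˡ    = ⊛-zeroˡ
    }
  }
  where
  semigroup : ∀ _∙_ → (∀ {f f′ g g′} → f ≗ f′ → g ≗ g′ → (f ∙ g) ≗ (f′ ∙ g′)) →
              (∀ f g h → ((f ∙ g) ∙ h) ≗ (f ∙ (g ∙ h))) → IsSemigroup _∙_
  semigroup _∙_ ∙-cong assoc = record
    { isMagma = record { isEquivalence = ≗-isEquivalence ; ∙-cong = ∙-cong }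
    ; assoc   = assoc
    }

open CommutativeSemiring seriesSemiring
  using (setoid)
  renaming (*-commutativeSemigroup to ⊛-commutativeSemigroup;
            +-commutativeSemigroup to ⊕-commutativeSemigroup;
            refl to ≗-refl; sym to ≗-sym; trans to ≗-trans; distribˡ to ⊛-distribˡ;
            +-cong to ⊕-cong; *-identityʳ to ⊛-identityʳ)
open import Algebra.Properties.CommutativeSemigroup ⊛-commutativeSemigroup
  using () renaming (interchange to ⊛-interchange; xy∙z≈xz∙y to [f⊛g]⊛h≗[f⊛h]⊛g)
open import Algebra.Properties.CommutativeSemigroup ⊕-commutativeSemigroup
  using () renaming (x∙yz≈y∙xz to f⊕[g⊕h]≗g⊕[f⊕h];
                     x∙yz≈xz∙y to f⊕[g⊕h]≗[f⊕h]⊕g)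
open import Algebra.Properties.CommutativeSemiring.Exp seriesSemiring
  using () renaming (_^_ to _^ˢ_; ^-distrib-* to ^ˢ-distrib-⊛; ^-homo-* to ^ˢ-homo-⊛;
                     ^-congˡ to ^ˢ-congˡ; ^-congʳ to ^ˢ-congʳ)
module ≗-Reasoning = Relation.Binary.Reasoning.Setoid setoid

⊛-congˡ : ∀ f {g g′} → g ≗ g′ → f ⊛ g ≗ f ⊛ g′
⊛-congˡ f = ⊛-cong (≗-refl {f})

⊛-congʳ : ∀ g {f f′} → f ≗ f′ → f ⊛ g ≗ f′ ⊛ g
⊛-congʳ g f≗f′ = ⊛-cong f≗f′ (≗-refl {g})

⊕-congˡ : ∀ f {g g′} → g ≗ g′ → f ⊕ g ≗ f ⊕ g′
⊕-congˡ f = ⊕-cong (≗-refl {f})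

⊕-congʳ : ∀ g {f f′} → f ≗ f′ → f ⊕ g ≗ f′ ⊕ g
⊕-congʳ g f≗f′ = ⊕-cong f≗f′ (≗-refl {g})

-- Multiplication by q^m

shift : ℕ → Series → Series
shift zero    f n       = f n
shift (suc m) f zero    = 0
shift (suc m) f (suc n) = shift m f n

shift-cong : ∀ m {f g} → f ≗ g → shift m f ≗ shift m g
shift-cong zero    f≗g n       = f≗g n
shift-cong (suc m) f≗g zero    = refl
shift-cong (suc m) f≗g (suc n) = shift-cong m f≗g n

shift-< : ∀ m f n → n < m → shift m f n ≡ 0
shift-< (suc m) f zero    _         = refl
shift-< (suc m) f (suc n) (s≤s n<m) = shift-< m f n n<m

shift-+ : ∀ m f n → shift m f (m + n) ≡ f n
shift-+ zero    f n = refl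
shift-+ (suc m) f n = shift-+ m f n

shift-∸ : ∀ m f n → m ≤ n → shift m f n ≡ f (n ∸ m)
shift-∸ m f n m≤n = trans (cong (shift m f) (sym (m+[n∸m]≡n m≤n))) (shift-+ m f (n ∸ m))

shift-cong-at : ∀ m f g n → (∀ k → m + k ≡ n → f k ≡ g k) → shift m f n ≡ shift m g n
shift-cong-at m f g n f≡g with m ≤? n
... | yes m≤n = trans (shift-∸ m f n m≤n)
  (trans (f≡g (n ∸ m) (m+[n∸m]≡n m≤n)) (sym (shift-∸ m g n m≤n)))
... | no m≰n  = trans (shift-< m f n (≰⇒> m≰n)) (sym (shift-< m g n (≰⇒> m≰n)))

shift-zeroS : ∀ m {f} → f ≗ zeroS → shift m f ≗ zeroS
shift-zeroS m f≗0 = ≗-trans (shift-cong m f≗0) (go m)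
  where
  go : ∀ m → shift m zeroS ≗ zeroS
  go zero    n       = refl
  go (suc m) zero    = refl
  go (suc m) (suc n) = go m n

shift-oneS : ∀ m n → shift m oneS n ≡ ind n m
shift-oneS zero    n       = refl
shift-oneS (suc m) zero    = refl
shift-oneS (suc m) (suc n) = shift-oneS m n

shift-shift : ∀ a b f → shift a (shift b f) ≗ shift (a + b) f
shift-shift zero    b f n       = refl
shift-shift (suc a) b f zero    = refl
shift-shift (suc a) b f (suc n) = shift-shift a b f n

shift-⊕ : ∀ m f g → shift m (f ⊕ g) ≗ shift m f ⊕ shift m g
shift-⊕ zero    f g n       = refl
shift-⊕ (suc m) f g zero    = refl
shift-⊕ (suc m) f g (suc n) = shift-⊕ m f g n

shift-⊛ˡ : ∀ m f g → shift m f ⊛ g ≗ shift m (f ⊛ g)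
shift-⊛ˡ zero    f g n       = refl
shift-⊛ˡ (suc m) f g zero    = refl
shift-⊛ˡ (suc m) f g (suc n) = trans (sumTo-sucˡ n _) (shift-⊛ˡ m f g n)

shift-⊛ʳ : ∀ m f g → f ⊛ shift m g ≗ shift m (f ⊛ g)
shift-⊛ʳ m f g = ≗-trans (⊛-comm f (shift m g))
                         (≗-trans (shift-⊛ˡ m g f) (shift-cong m (⊛-comm g f)))

-- The substitution q ↦ q^m

subQ-* : ∀ m j f → subQ (suc m) f (j * suc m) ≡ f j
subQ-* m j f = begin
  sumTo (j * suc m) (λ k → ind (k * suc m) (j * suc m) * f k)
    ≡⟨ sumTo-single (j * suc m) j _ (m≤m*n j (suc m)) (λ k _ k≢j →
         cong (_* f k) (ind-≢ (k * suc m) (j * suc m) (k≢j ∘ *-cancelʳ-≡ k j (suc m)))) ⟩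
  ind (j * suc m) (j * suc m) * f j
    ≡⟨ cong (_* f j) (ind-refl (j * suc m)) ⟩
  1 * f j
    ≡⟨ *-identityˡ (f j) ⟩
  f j ∎
  where open ≡-Reasoning

subQ-∤ : ∀ m f d → ¬ (suc m ∣ d) → subQ (suc m) f d ≡ 0
subQ-∤ m f d m∤d = sumTo-zero d _ λ k _ →
  cong (_* f k) (ind-≢ (k * suc m) d (λ k*m≡d → m∤d (divides k (sym k*m≡d))))

subQ-cong-≤ : ∀ m d {f g} → f ≗[≤ d ] g → subQ (suc m) f ≗[≤ d ] subQ (suc m) g
subQ-cong-≤ m d f≈g k k≤d =
  sumTo-cong k (λ j j≤k → cong (ind (j * suc m) k *_) (f≈g j (≤-trans j≤k k≤d)))

subQ-cong : ∀ m {f g} → f ≗ g → subQ (suc m) f ≗ subQ (suc m) g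
subQ-cong m f≗g n = subQ-cong-≤ m n (λ k _ → f≗g k) n ≤-refl

subQ-⊕ : ∀ m f g → subQ m (f ⊕ g) ≗ subQ m f ⊕ subQ m g
subQ-⊕ m f g n =
  trans (sumTo-cong n (λ k _ → *-distribˡ-+ (ind (k * m) n) (f k) (g k))) (sumTo-+ n _ _)

subQ-oneS : ∀ m → subQ (suc m) oneS ≗ oneS
subQ-oneS m d with suc m ∣? d
... | yes (divides zero    refl) = subQ-* m 0 oneS
... | yes (divides (suc t) refl) = subQ-* m (suc t) oneS
... | no m∤d = trans (subQ-∤ m oneS d m∤d) (sym (oneS-∤ d m∤d))
  where
  oneS-∤ : ∀ d → ¬ (suc m ∣ d) → oneS d ≡ 0
  oneS-∤ zero    m∤0 = ⊥-elim (m∤0 (divides 0 refl))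
  oneS-∤ (suc d) _   = refl

sumTo-multiples : ∀ m t (φ : ℕ → ℕ) → (∀ k → ¬ (suc m ∣ k) → φ k ≡ 0) →
                  sumTo (t * suc m) φ ≡ sumTo t (λ j → φ (j * suc m))
sumTo-multiples m zero    φ φ≡0 = refl
sumTo-multiples m (suc t) φ φ≡0 = begin
  sumTo (suc m + t * suc m) φ
    ≡⟨ cong (λ u → sumTo u φ) (+-comm (suc m) (t * suc m)) ⟩
  sumTo (t * suc m + suc m) φ
    ≡⟨ sumTo-split (t * suc m) m φ ⟩
  sumTo (t * suc m) φ + sumTo m (λ r → φ (t * suc m + suc r))
    ≡⟨ cong₂ _+_ (sumTo-multiples m t φ φ≡0)
                 (sumTo-single m m _ ≤-refl (λ r r≤m r≢m → φ≡0 _ (∤ r r≤m r≢m))) ⟩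
  sumTo t (λ j → φ (j * suc m)) + φ (t * suc m + suc m)
    ≡⟨ cong (λ u → sumTo t (λ j → φ (j * suc m)) + φ u) (+-comm (t * suc m) (suc m)) ⟩
  sumTo t (λ j → φ (j * suc m)) + φ (suc m + t * suc m) ∎
  where
  open ≡-Reasoning
  ∤ : ∀ r → r ≤ m → r ≢ m → ¬ (suc m ∣ t * suc m + suc r)
  ∤ r r≤m r≢m m∣ = <⇒≱ (s≤s (≤∧≢⇒< r≤m r≢m)) (∣⇒≤ (∣m+n∣m⇒∣n m∣ (n∣m*n t)))

subQ-⊛ : ∀ m f g → subQ (suc m) (f ⊛ g) ≗ subQ (suc m) f ⊛ subQ (suc m) g
subQ-⊛ m f g d with suc m ∣? d
... | yes (divides t refl) = sym (begin
  sumTo (t * suc m) (λ k → subQ (suc m) f k * subQ (suc m) g (t * suc m ∸ k))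
    ≡⟨ sumTo-multiples m t _ (λ k m∤k → cong (_* _) (subQ-∤ m f k m∤k)) ⟩
  sumTo t (λ j → subQ (suc m) f (j * suc m) * subQ (suc m) g (t * suc m ∸ j * suc m))
    ≡⟨ sumTo-cong t (λ j _ → cong₂ _*_ (subQ-* m j f) (trans
         (cong (subQ (suc m) g) (sym (*-distribʳ-∸ (suc m) t j))) (subQ-* m (t ∸ j) g))) ⟩
  (f ⊛ g) t
    ≡⟨ subQ-* m t (f ⊛ g) ⟨
  subQ (suc m) (f ⊛ g) (t * suc m) ∎)
  where open ≡-Reasoning
... | no m∤d = trans (subQ-∤ m (f ⊛ g) d m∤d) (sym (sumTo-zero d _ term≡0))
  where
  term≡0 : ∀ k → k ≤ d → subQ (suc m) f k * subQ (suc m) g (d ∸ k) ≡ 0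
  term≡0 k k≤d with suc m ∣? k | suc m ∣? (d ∸ k)
  ... | no m∤k | _        = cong (_* subQ (suc m) g (d ∸ k)) (subQ-∤ m f k m∤k)
  ... | yes _  | no m∤d-k =
    trans (cong (subQ (suc m) f k *_) (subQ-∤ m g (d ∸ k) m∤d-k)) (*-zeroʳ (subQ (suc m) f k))
  ... | yes m∣k | yes m∣d-k = ⊥-elim (m∤d (∣m∸n∣n⇒∣m (suc m) k≤d m∣d-k m∣k))

subQ-subQ : ∀ a b f → subQ (suc a) (subQ (suc b) f) ≗ subQ (suc b * suc a) f
subQ-subQ a b f d with (suc b * suc a) ∣? d
... | yes (divides s refl) = begin
  subQ (suc a) (subQ (suc b) f) (s * (suc b * suc a))
    ≡⟨ cong (subQ (suc a) (subQ (suc b) f)) (*-assoc s (suc b) (suc a)) ⟨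
  subQ (suc a) (subQ (suc b) f) (s * suc b * suc a)
    ≡⟨ subQ-* a (s * suc b) (subQ (suc b) f) ⟩
  subQ (suc b) f (s * suc b)
    ≡⟨ subQ-* b s f ⟩
  f s
    ≡⟨ subQ-* (a + b * suc a) s f ⟨
  subQ (suc b * suc a) f (s * (suc b * suc a)) ∎
  where open ≡-Reasoning
... | no ba∤d = trans lhs≡0 (sym (subQ-∤ (a + b * suc a) f d ba∤d))
  where
  lhs≡0 : subQ (suc a) (subQ (suc b) f) d ≡ 0
  lhs≡0 with suc a ∣? d
  ... | no a∤d = subQ-∤ a _ d a∤d
  ... | yes (divides t refl) with suc b ∣? t
  ...   | no b∤t = trans (subQ-* a t _) (subQ-∤ b f t b∤t)
  ...   | yes (divides s refl) = ⊥-elim (ba∤d (divides s (*-assoc s (suc b) (suc a))))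

subQ-shift : ∀ m a f → subQ (suc m) (shift a f) ≗ shift (a * suc m) (subQ (suc m) f)
subQ-shift m a f d with suc m ∣? d
... | yes (divides t refl) = trans (subQ-* m t (shift a f)) (sym (multiple t))
  where
  multiple : ∀ t → shift (a * suc m) (subQ (suc m) f) (t * suc m) ≡ shift a f t
  multiple t with a ≤? t
  ... | no a≰t = trans (shift-< (a * suc m) _ (t * suc m) (*-monoˡ-< (suc m) (≰⇒> a≰t)))
                       (sym (shift-< a f t (≰⇒> a≰t)))
  ... | yes a≤t = begin
    shift (a * suc m) (subQ (suc m) f) (t * suc m)
      ≡⟨ shift-∸ (a * suc m) _ (t * suc m) (*-monoˡ-≤ (suc m) a≤t) ⟩
    subQ (suc m) f (t * suc m ∸ a * suc m)
      ≡⟨ cong (subQ (suc m) f) (*-distribʳ-∸ (suc m) t a) ⟨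
    subQ (suc m) f ((t ∸ a) * suc m)
      ≡⟨ subQ-* m (t ∸ a) f ⟩
    f (t ∸ a)
      ≡⟨ shift-∸ a f t a≤t ⟨
    shift a f t ∎
    where open ≡-Reasoning
... | no m∤d = trans (subQ-∤ m (shift a f) d m∤d) (sym rhs≡0)
  where
  rhs≡0 : shift (a * suc m) (subQ (suc m) f) d ≡ 0
  rhs≡0 with a * suc m ≤? d
  ... | no am≰d = shift-< (a * suc m) _ d (≰⇒> am≰d)
  ... | yes am≤d = trans (shift-∸ (a * suc m) _ d am≤d)
                         (subQ-∤ m f _ (λ m∣ → m∤d (∣m∸n∣n⇒∣m (suc m) am≤d m∣ (n∣m*n a))))

^ˢ-cong-≤ : ∀ e d {f g} → f ≗[≤ d ] g → f ^ˢ e ≗[≤ d ] g ^ˢ e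
^ˢ-cong-≤ zero    d f≈g k _ = refl
^ˢ-cong-≤ (suc e) d f≈g     = ⊛-cong-≤ d f≈g (^ˢ-cong-≤ e d f≈g)

powS≗^ˢ : ∀ f e → powS f e ≗ f ^ˢ e
powS≗^ˢ f zero    = ≗-refl
powS≗^ˢ f (suc e) = ⊛-congˡ f (powS≗^ˢ f e)

prodTo-cong : ∀ N {F G : ℕ → Series} → (∀ i → F (suc i) ≗ G (suc i)) → prodTo N F ≗ prodTo N G
prodTo-cong zero    F≗G = ≗-refl
prodTo-cong (suc N) F≗G = ⊛-cong (prodTo-cong N F≗G) (F≗G N)

prodTo-⊛ : ∀ N (F G : ℕ → Series) → prodTo N (λ i → F i ⊛ G i) ≗ prodTo N F ⊛ prodTo N G
prodTo-⊛ zero    F G = ≗-sym (⊛-identityˡ oneS)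
prodTo-⊛ (suc N) F G = ≗-trans (⊛-congʳ (F (suc N) ⊛ G (suc N)) (prodTo-⊛ N F G))
                               (⊛-interchange (prodTo N F) (prodTo N G) (F (suc N)) (G (suc N)))

prodTo-^ˢ : ∀ N (F : ℕ → Series) e → prodTo N (λ i → F i ^ˢ e) ≗ prodTo N F ^ˢ e
prodTo-^ˢ zero    F e = ≗-sym (oneS^ˢ e)
  where
  oneS^ˢ : ∀ e → oneS ^ˢ e ≗ oneS
  oneS^ˢ zero    = ≗-refl
  oneS^ˢ (suc e) = ≗-trans (⊛-identityˡ (oneS ^ˢ e)) (oneS^ˢ e)
prodTo-^ˢ (suc N) F e = ≗-trans (⊛-congʳ (F (suc N) ^ˢ e) (prodTo-^ˢ N F e))
                                (≗-sym (^ˢ-distrib-⊛ (prodTo N F) (F (suc N)) e))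

subQ-prodTo : ∀ m N (F : ℕ → Series) →
              subQ (suc m) (prodTo N F) ≗ prodTo N (λ i → subQ (suc m) (F i))
subQ-prodTo m zero    F = subQ-oneS m
subQ-prodTo m (suc N) F = ≗-trans (subQ-⊛ m (prodTo N F) (F (suc N)))
                                  (⊛-congʳ (subQ (suc m) (F (suc N))) (subQ-prodTo m N F))

OneMod : ℕ → Series → Set
OneMod i f = ∀ k → k < i → f k ≡ oneS k

OneMod-≤ : ∀ {i j f} → i ≤ j → OneMod j f → OneMod i f
OneMod-≤ i≤j f≡1 k k<i = f≡1 k (≤-trans k<i i≤j)

OneMod-⊛ : ∀ i {f g} → OneMod i f → OneMod i g → OneMod i (f ⊛ g)
OneMod-⊛ i f≡1 g≡1 k k<i = trans
  (⊛-cong-≤ k (λ j j≤k → f≡1 j (≤-<-trans j≤k k<i))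
              (λ j j≤k → g≡1 j (≤-<-trans j≤k k<i)) k ≤-refl)
  (⊛-identityˡ oneS k)

OneMod-^ˢ : ∀ i e {f} → OneMod i f → OneMod i (f ^ˢ e)
OneMod-^ˢ i zero    f≡1 k _ = refl
OneMod-^ˢ i (suc e) f≡1     = OneMod-⊛ i f≡1 (OneMod-^ˢ i e f≡1)

OneMod-subQ : ∀ m .{{_ : NonZero m}} f → f 0 ≡ 1 → OneMod m (subQ m f)
OneMod-subQ (suc m) f f₀≡1 zero    _         = trans (+-identityʳ (f 0)) f₀≡1
OneMod-subQ (suc m) f f₀≡1 (suc k) (s≤s k<m) = subQ-∤ m f (suc k) (λ m∣ → <⇒≱ (s≤s k<m) (∣⇒≤ m∣))

⊛-OneMod : ∀ d f {g} → OneMod (suc d) g → f ⊛ g ≗[≤ d ] f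
⊛-OneMod d f g≡1 k k≤d = trans
  (⊛-cong-≤ k {f} {f} (λ _ _ → refl) (λ j j≤k → g≡1 j (s≤s (≤-trans j≤k k≤d))) k ≤-refl)
  (⊛-identityʳ f k)

Convergent : (ℕ → Series) → Set
Convergent F = ∀ i → OneMod (suc i) (F (suc i))

prodTo-+ : ∀ N e F → Convergent F → prodTo (N + e) F ≗[≤ N ] prodTo N F
prodTo-+ N zero    F conv k k≤N rewrite +-identityʳ N = refl
prodTo-+ N (suc e) F conv k k≤N rewrite +-suc N e =
  trans (⊛-OneMod N (prodTo (N + e) F) (OneMod-≤ (s≤s (m≤m+n N e)) (conv (N + e))) k k≤N)
        (prodTo-+ N e F conv k k≤N)

prodTo≗infProd : ∀ N F → Convergent F → prodTo N F ≗[≤ N ] infProd F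
prodTo≗infProd N F conv d d≤N = begin
  prodTo N F d             ≡⟨ cong (λ u → prodTo u F d) (m+[n∸m]≡n d≤N) ⟨
  prodTo (d + (N ∸ d)) F d ≡⟨ prodTo-+ d (N ∸ d) F conv d ≤-refl ⟩
  prodTo d F d             ∎
  where open ≡-Reasoning

-- Euler's identity

geomS-unfold : geomS ≗ oneS ⊕ shift 1 geomS
geomS-unfold zero    = refl
geomS-unfold (suc n) = refl

subQ-1+q* : ∀ m f → subQ (suc m) (oneS ⊕ shift 1 f) ≗ oneS ⊕ shift (suc m) (subQ (suc m) f)
subQ-1+q* m f = ≗-trans (subQ-⊕ (suc m) oneS (shift 1 f)) (⊕-cong (subQ-oneS m)
  (≗-trans (subQ-shift m 1 f) (λ n → cong (λ u → shift u (subQ (suc m) f) n) (*-identityˡ (suc m)))))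

subQ-geomS-unfold : ∀ m → subQ (suc m) geomS ≗ oneS ⊕ shift (suc m) (subQ (suc m) geomS)
subQ-geomS-unfold m = ≗-trans (subQ-cong m geomS-unfold) (subQ-1+q* m geomS)

subQ2-geomS-+shift : subQ 2 geomS ⊕ shift 1 (subQ 2 geomS) ≗ geomS
subQ2-geomS-+shift zero          = refl
subQ2-geomS-+shift (suc zero)    = refl
subQ2-geomS-+shift (suc (suc n)) = begin
  g₂ (suc (suc n)) + g₂ (suc n) ≡⟨ cong (_+ g₂ (suc n)) (subQ-geomS-unfold 1 (suc (suc n))) ⟩
  g₂ n + g₂ (suc n)             ≡⟨ +-comm (g₂ n) (g₂ (suc n)) ⟩
  g₂ (suc n) + g₂ n             ≡⟨ subQ2-geomS-+shift (suc n) ⟩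
  1                             ∎
  where
  open ≡-Reasoning
  g₂ = subQ 2 geomS

1+q^ : ℕ → Series
1+q^ m = oneS ⊕ shift m oneS

1+q^-⊛ : ∀ m f → 1+q^ m ⊛ f ≗ f ⊕ shift m f
1+q^-⊛ m f = begin
  (oneS ⊕ shift m oneS) ⊛ f       ≈⟨ ⊛-distribʳ f oneS (shift m oneS) ⟩
  oneS ⊛ f ⊕ shift m oneS ⊛ f     ≈⟨ ⊕-cong (⊛-identityˡ f) (shift-⊛ˡ m oneS f) ⟩
  f ⊕ shift m (oneS ⊛ f)          ≈⟨ ⊕-congˡ f (shift-cong m (⊛-identityˡ f)) ⟩
  f ⊕ shift m f                   ∎
  where open ≗-Reasoning

geomS-split : geomS ≗ 1+q^ 1 ⊛ subQ 2 geomS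
geomS-split = ≗-sym (≗-trans (1+q^-⊛ 1 (subQ 2 geomS)) subQ2-geomS-+shift)

partitions≤ : ℕ → Series
partitions≤ N = prodTo N (λ j → subQ j geomS)

partitions : Series
partitions = infProd (λ j → subQ j geomS)

distinctPartitions≤ : ℕ → Series
distinctPartitions≤ N = prodTo N 1+q^

distinctPartitions : Series
distinctPartitions = infProd 1+q^

partitions-convergent : Convergent (λ j → subQ j geomS)
partitions-convergent i = OneMod-subQ (suc i) geomS refl

distinctPartitions-convergent : Convergent 1+q^
distinctPartitions-convergent i k k<i =
  trans (cong (oneS k +_) (shift-< (suc i) oneS k k<i)) (+-identityʳ _)

partitions≤≗partitions : ∀ N → partitions≤ N ≗[≤ N ] partitions
partitions≤≗partitions N = prodTo≗infProd N _ partitions-convergent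

distinctPartitions≤≗distinctPartitions : ∀ N → distinctPartitions≤ N ≗[≤ N ] distinctPartitions
distinctPartitions≤≗distinctPartitions N = prodTo≗infProd N _ distinctPartitions-convergent

subQ2-partitions≤ : ∀ N → subQ 2 (partitions≤ N) ≗ prodTo N (λ j → subQ (2 * j) geomS)
subQ2-partitions≤ N = ≗-trans (subQ-prodTo 1 N _) (prodTo-cong N λ i →
  ≗-trans (subQ-subQ 1 i geomS) (λ n → cong (λ m → subQ m geomS n) (*-comm (suc i) 2)))

euler-factor : ∀ j → 1+q^ (suc j) ⊛ subQ (2 * suc j) geomS ≗ subQ (suc j) geomS
euler-factor j = ≗-sym (begin
  subQ (suc j) geomS
    ≈⟨ subQ-cong j geomS-split ⟩
  subQ (suc j) (1+q^ 1 ⊛ subQ 2 geomS)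
    ≈⟨ subQ-⊛ j (1+q^ 1) (subQ 2 geomS) ⟩
  subQ (suc j) (1+q^ 1) ⊛ subQ (suc j) (subQ 2 geomS)
    ≈⟨ ⊛-cong (≗-trans (subQ-1+q* j oneS) (⊕-congˡ oneS (shift-cong (suc j) (subQ-oneS j))))
              (subQ-subQ j 1 geomS) ⟩
  1+q^ (suc j) ⊛ subQ (2 * suc j) geomS ∎)
  where open ≗-Reasoning

euler≤ : ∀ N → distinctPartitions≤ N ⊛ subQ 2 (partitions≤ N) ≗ partitions≤ N
euler≤ N = begin
  distinctPartitions≤ N ⊛ subQ 2 (partitions≤ N)
    ≈⟨ ⊛-congˡ (distinctPartitions≤ N) (subQ2-partitions≤ N) ⟩
  distinctPartitions≤ N ⊛ prodTo N (λ j → subQ (2 * j) geomS)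
    ≈⟨ prodTo-⊛ N _ _ ⟨
  prodTo N (λ j → 1+q^ j ⊛ subQ (2 * j) geomS)
    ≈⟨ prodTo-cong N euler-factor ⟩
  partitions≤ N ∎
  where open ≗-Reasoning

euler : distinctPartitions ⊛ subQ 2 partitions ≗ partitions
euler = ≗[≤]⇒≗ λ N → ≗[≤]-trans N
  (⊛-cong-≤ N (≗[≤]-sym N (distinctPartitions≤≗distinctPartitions N))
              (subQ-cong-≤ 1 N (≗[≤]-sym N (partitions≤≗partitions N))))
  (≗[≤]-trans N (≗⇒≗[≤] N (euler≤ N)) (partitions≤≗partitions N))

-- Gaussian binomial coefficients

qBinomial : ℕ → ℕ → Series
qBinomial zero    zero    = oneS
qBinomial zero    (suc i) = zeroS
qBinomial (suc N) zero    = oneS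
qBinomial (suc N) (suc i) = qBinomial N i ⊕ shift (suc i) (qBinomial N (suc i))

qBinomial-> : ∀ N i → N < i → qBinomial N i ≗ zeroS
qBinomial-> zero    (suc i) _         n = refl
qBinomial-> (suc N) (suc i) (s≤s N<i) n = cong₂ _+_ (qBinomial-> N i N<i n)
  (shift-zeroS (suc i) (qBinomial-> N (suc i) (m<n⇒m<1+n N<i)) n)

qBinomial-diag : ∀ N → qBinomial N N ≗ oneS
qBinomial-diag zero    = ≗-refl
qBinomial-diag (suc N) n = trans (cong₂ _+_ (qBinomial-diag N n)
  (shift-zeroS (suc N) (qBinomial-> N (suc N) ≤-refl) n)) (+-identityʳ _)

qBinomial-zero : ∀ N → qBinomial N 0 ≗ oneS
qBinomial-zero zero    = ≗-refl
qBinomial-zero (suc N) = ≗-refl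

qBinomial-pascal′ : ∀ N i → qBinomial (suc N) (suc i) ≗ shift (N ∸ i) (qBinomial N i) ⊕ qBinomial N (suc i)
qBinomial-pascal′ zero    zero    n = cong (oneS n +_) (shift-zeroS 1 (λ _ → refl) n)
qBinomial-pascal′ zero    (suc i) n = shift-zeroS (suc (suc i)) (λ _ → refl) n
qBinomial-pascal′ (suc N) zero    n = begin
  oneS n + shift 1 (qBinomial (suc N) 1) n
    ≡⟨ cong (oneS n +_) (shift-cong 1 (qBinomial-pascal′ N 0) n) ⟩
  oneS n + shift 1 (shift N (qBinomial N 0) ⊕ qBinomial N 1) n
    ≡⟨ cong (oneS n +_) (shift-⊕ 1 (shift N (qBinomial N 0)) (qBinomial N 1) n) ⟩
  oneS n + (shift 1 (shift N (qBinomial N 0)) n + shift 1 (qBinomial N 1) n)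
    ≡⟨ cong (λ x → oneS n + (x + shift 1 (qBinomial N 1) n))
            (trans (shift-shift 1 N _ n) (shift-cong (suc N) (qBinomial-zero N) n)) ⟩
  oneS n + (shift (suc N) oneS n + shift 1 (qBinomial N 1) n)
    ≡⟨ x+[y+z]≡y+[x+z] (oneS n) (shift (suc N) oneS n) (shift 1 (qBinomial N 1) n) ⟩
  shift (suc N) oneS n + (oneS n + shift 1 (qBinomial N 1) n)
    ≡⟨ cong (λ x → shift (suc N) oneS n + (x + shift 1 (qBinomial N 1) n)) (qBinomial-zero N n) ⟨
  shift (suc N) oneS n + qBinomial (suc N) 1 n ∎
  where open ≡-Reasoning
qBinomial-pascal′ (suc N) (suc j) n with <-cmp j N
... | tri< j<N _ _ = begin
  qBinomial (suc N) (suc j) n + shift (2 + j) (qBinomial (suc N) (2 + j)) n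
    ≡⟨ cong₂ _+_ (qBinomial-pascal′ N j n) (shift-cong (2 + j) (qBinomial-pascal′ N (suc j)) n) ⟩
  (A + B) + shift (2 + j) (shift (N ∸ suc j) (qBinomial N (suc j)) ⊕ qBinomial N (2 + j)) n
    ≡⟨ cong (A + B +_) (shift-⊕ (2 + j) _ _ n) ⟩
  (A + B) + (shift (2 + j) (shift (N ∸ suc j) (qBinomial N (suc j))) n + D)
    ≡⟨ cong (λ x → A + B + (x + D)) (shift-shift-≡ (2 + j) (N ∸ suc j) (cong suc (m+[n∸m]≡n j<N))) ⟩
  (A + B) + (C + D)
    ≡⟨ +-interchange A B C D ⟩
  (A + C) + (B + D)
    ≡⟨ cong (_+ (B + D)) (cong (A +_) (shift-shift-≡ (N ∸ j) (suc j)
         (trans (+-suc (N ∸ j) j) (cong suc (m∸n+n≡m (<⇒≤ j<N)))))) ⟨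
  (A + shift (N ∸ j) (shift (suc j) (qBinomial N (suc j))) n) + (B + D)
    ≡⟨ cong (_+ (B + D)) (shift-⊕ (N ∸ j) (qBinomial N j) _ n) ⟨
  shift (N ∸ j) (qBinomial (suc N) (suc j)) n + qBinomial (suc N) (2 + j) n ∎
  where
  open ≡-Reasoning
  A = shift (N ∸ j) (qBinomial N j) n
  B = qBinomial N (suc j) n
  C = shift (suc N) (qBinomial N (suc j)) n
  D = shift (2 + j) (qBinomial N (2 + j)) n
  shift-shift-≡ : ∀ a b → a + b ≡ suc N → shift a (shift b (qBinomial N (suc j))) n ≡ C
  shift-shift-≡ a b a+b≡ = trans (shift-shift a b _ n) (cong (λ u → shift u (qBinomial N (suc j)) n) a+b≡)
... | tri≈ _ refl _ = begin
  qBinomial (suc j) (suc j) n + shift (2 + j) (qBinomial (suc j) (2 + j)) n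
    ≡⟨ cong₂ _+_ (qBinomial-diag (suc j) n) (shift-zeroS (2 + j) (qBinomial-> (suc j) (2 + j) ≤-refl) n) ⟩
  oneS n + 0
    ≡⟨ cong₂ _+_ (trans (cong (λ u → shift u (qBinomial (suc j) (suc j)) n) (n∸n≡0 j))
                        (qBinomial-diag (suc j) n))
                 (qBinomial-> (suc j) (2 + j) ≤-refl n) ⟨
  shift (j ∸ j) (qBinomial (suc j) (suc j)) n + qBinomial (suc j) (2 + j) n ∎
  where open ≡-Reasoning
... | tri> _ _ N<j = trans
  (cong₂ _+_ (qBinomial-> (suc N) (suc j) (s≤s N<j) n) (shift-zeroS (2 + j) (qBinomial-> (suc N) (2 + j) N+1<j+2) n))
  (sym (cong₂ _+_ (shift-zeroS (N ∸ j) (qBinomial-> (suc N) (suc j) (s≤s N<j)) n)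
                  (qBinomial-> (suc N) (2 + j) N+1<j+2 n)))
  where
  N+1<j+2 : suc N < 2 + j
  N+1<j+2 = s≤s (m<n⇒m<1+n N<j)

partitions≤-unfold : ∀ i → partitions≤ (suc i) ≗ partitions≤ i ⊕ shift (suc i) (partitions≤ (suc i))
partitions≤-unfold i = begin
  partitions≤ i ⊛ subQ (suc i) geomS
    ≈⟨ ⊛-congˡ (partitions≤ i) (subQ-geomS-unfold i) ⟩
  partitions≤ i ⊛ (oneS ⊕ shift (suc i) (subQ (suc i) geomS))
    ≈⟨ ⊛-distribˡ (partitions≤ i) oneS (shift (suc i) (subQ (suc i) geomS)) ⟩
  partitions≤ i ⊛ oneS ⊕ partitions≤ i ⊛ shift (suc i) (subQ (suc i) geomS)
    ≈⟨ ⊕-cong (⊛-identityʳ (partitions≤ i)) (shift-⊛ʳ (suc i) (partitions≤ i) (subQ (suc i) geomS)) ⟩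
  partitions≤ i ⊕ shift (suc i) (partitions≤ (suc i)) ∎
  where open ≗-Reasoning

-- [N, i] and 1/(q; q)_i = partitions≤ i obey the same recurrence (partitions≤-unfold).
qBinomial-partitions≤ : ∀ N i k → k + i ≤ N → qBinomial N i k ≡ partitions≤ i k
qBinomial-partitions≤ zero    zero    zero _ = refl
qBinomial-partitions≤ zero    (suc i) k    k+i+1≤0 =
  ⊥-elim (<⇒≱ (s≤s z≤n) (≤-trans (m≤n+m (suc i) k) k+i+1≤0))
qBinomial-partitions≤ (suc N) zero    k    _ = refl
qBinomial-partitions≤ (suc N) (suc i) k    k+i+1≤N+1 = trans
  (cong₂ _+_ (qBinomial-partitions≤ N i k k+i≤N)
             (shift-cong-at (suc i) _ _ k λ k′ i+1+k′≡k →
                qBinomial-partitions≤ N (suc i) k′ (k′+i+1≤N i+1+k′≡k)))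
  (sym (partitions≤-unfold i k))
  where
  k+i≤N : k + i ≤ N
  k+i≤N = ≤-pred (subst (_≤ suc N) (+-suc k i) k+i+1≤N+1)
  k′+i+1≤N : ∀ {k′} → suc i + k′ ≡ k → k′ + suc i ≤ N
  k′+i+1≤N {k′} refl = ≤-trans (≤-reflexive (+-comm k′ (suc i))) (≤-trans (m≤m+n (suc i + k′) i) k+i≤N)

-- A finite form of Gauss's identity

tri : ℕ → ℕ
tri zero    = 0
tri (suc k) = suc k + tri k

-- triExp n i = tri (n - i) for i ≤ n and tri (i - n - 1) for i > n, i.e. (i - n)(i - n - 1)/2.
triExp : ℕ → ℕ → ℕ
triExp zero    zero    = 0
triExp zero    (suc i) = tri i
triExp (suc n) zero    = tri (suc n)
triExp (suc n) (suc i) = triExp n i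

triExp-zero : ∀ n → triExp n 0 ≡ tri n
triExp-zero zero    = refl
triExp-zero (suc n) = refl

triExp-suc : ∀ n j → triExp n j + suc j ≡ triExp n (suc j) + suc n
triExp-suc zero    zero    = refl
triExp-suc zero    (suc j) = lemma (tri j) j
  where
  lemma : ∀ t j → t + suc (suc j) ≡ suc j + t + 1
  lemma = solve-∀
triExp-suc (suc n) zero    = trans (cong (λ t → suc n + t + 1) (sym (triExp-zero n))) (lemma (triExp n 0) n)
  where
  lemma : ∀ t n → suc n + t + 1 ≡ t + suc (suc n)
  lemma = solve-∀
triExp-suc (suc n) (suc j) =
  trans (+-suc (triExp n j) (suc j)) (trans (cong suc (triExp-suc n j)) (sym (+-suc _ (suc n))))

sumS : ℕ → (ℕ → Series) → Series
sumS M h m = sumTo M (λ i → h i m)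

sumS-cong : ∀ M {h h′ : ℕ → Series} → (∀ i → i ≤ M → h i ≗ h′ i) → sumS M h ≗ sumS M h′
sumS-cong M h≗h′ m = sumTo-cong M (λ i i≤M → h≗h′ i i≤M m)

sumS-⊕ : ∀ M (h h′ : ℕ → Series) → sumS M (λ i → h i ⊕ h′ i) ≗ sumS M h ⊕ sumS M h′
sumS-⊕ M h h′ m = sumTo-+ M (λ i → h i m) (λ i → h′ i m)

sumS-sucˡ : ∀ M (h : ℕ → Series) → sumS (suc M) h ≗ h 0 ⊕ sumS M (λ i → h (suc i))
sumS-sucˡ M h m = sumTo-sucˡ M (λ i → h i m)

sumS-rotate : ∀ M (h : ℕ → Series) → h (suc M) ≗ zeroS → sumS M h ≗ h 0 ⊕ sumS M (λ i → h (suc i))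
sumS-rotate M h h≗0 m = begin
  sumTo M (λ i → h i m)          ≡⟨ +-identityʳ _ ⟨
  sumTo M (λ i → h i m) + 0      ≡⟨ cong (sumTo M (λ i → h i m) +_) (h≗0 m) ⟨
  sumTo (suc M) (λ i → h i m)    ≡⟨ sumTo-sucˡ M (λ i → h i m) ⟩
  h 0 m + sumS M (λ i → h (suc i)) m ∎
  where open ≡-Reasoning

shift-sumS : ∀ a M h → shift a (sumS M h) ≗ sumS M (λ i → shift a (h i))
shift-sumS zero    M h m       = refl
shift-sumS (suc a) M h zero    = sym (sumTo-zero M _ (λ _ _ → refl))
shift-sumS (suc a) M h (suc m) = shift-sumS a M h m

sumS-⊛ : ∀ M h g → sumS M h ⊛ g ≗ sumS M (λ i → h i ⊛ g)
sumS-⊛ M h g m = trans (sumTo-cong m (λ k _ → sym (sumTo-*ʳ M (g (m ∸ k)) (λ i → h i k))))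
                       (sumTo-comm m M (λ i k → h i k * g (m ∸ k)))

tripleSum : ℕ → ℕ → Series
tripleSum n M = sumS M (λ i → shift (triExp n i) (qBinomial M i))

tripleSum-sucˡ : ∀ n K → tripleSum (suc n) (suc K) ≗ tripleSum n K ⊕ shift (suc n) (tripleSum n K)
tripleSum-sucˡ n K = begin
  tripleSum (suc n) (suc K)
    ≈⟨ sumS-sucˡ K _ ⟩
  shift (tri (suc n)) oneS ⊕ sumS K (λ j → shift (triExp n j) (qBinomial (suc K) (suc j)))
    ≈⟨ ⊕-congˡ (shift (tri (suc n)) oneS) (sumS-cong K (λ j _ → pascal j)) ⟩
  shift (tri (suc n)) oneS ⊕ sumS K (λ j → h j ⊕ shift (suc n) (h (suc j)))
    ≈⟨ ⊕-congˡ (shift (tri (suc n)) oneS) (sumS-⊕ K h (λ j → shift (suc n) (h (suc j)))) ⟩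
  shift (tri (suc n)) oneS ⊕ (tripleSum n K ⊕ sumS K (λ j → shift (suc n) (h (suc j))))
    ≈⟨ f⊕[g⊕h]≗g⊕[f⊕h] (shift (tri (suc n)) oneS) (tripleSum n K) _ ⟩
  tripleSum n K ⊕ (shift (tri (suc n)) oneS ⊕ sumS K (λ j → shift (suc n) (h (suc j))))
    ≈⟨ ⊕-congˡ (tripleSum n K) (⊕-congʳ (sumS K (λ j → shift (suc n) (h (suc j)))) head) ⟨
  tripleSum n K ⊕ (shift (suc n) (h 0) ⊕ sumS K (λ j → shift (suc n) (h (suc j))))
    ≈⟨ ⊕-congˡ (tripleSum n K) (sumS-rotate K (λ j → shift (suc n) (h j))
         (shift-zeroS (suc n) (shift-zeroS (triExp n (suc K)) (qBinomial-> K (suc K) ≤-refl)))) ⟨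
  tripleSum n K ⊕ sumS K (λ j → shift (suc n) (h j))
    ≈⟨ ⊕-congˡ (tripleSum n K) (shift-sumS (suc n) K h) ⟨
  tripleSum n K ⊕ shift (suc n) (tripleSum n K) ∎
  where
  open ≗-Reasoning
  h : ℕ → Series
  h j = shift (triExp n j) (qBinomial K j)
  head : shift (suc n) (h 0) ≗ shift (tri (suc n)) oneS
  head = ≗-trans (shift-shift (suc n) (triExp n 0) (qBinomial K 0)) (≗-trans
    (λ m → cong (λ u → shift (suc n + u) (qBinomial K 0) m) (triExp-zero n))
    (shift-cong (tri (suc n)) (qBinomial-zero K)))
  pascal : ∀ j → shift (triExp n j) (qBinomial (suc K) (suc j)) ≗ h j ⊕ shift (suc n) (h (suc j))
  pascal j = ≗-trans (shift-⊕ (triExp n j) (qBinomial K j) _) (⊕-congˡ (h j) (begin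
    shift (triExp n j) (shift (suc j) (qBinomial K (suc j)))
      ≈⟨ shift-shift (triExp n j) (suc j) _ ⟩
    shift (triExp n j + suc j) (qBinomial K (suc j))
      ≈⟨ (λ m → cong (λ u → shift u (qBinomial K (suc j)) m) (trans (triExp-suc n j) (+-comm _ (suc n)))) ⟩
    shift (suc n + triExp n (suc j)) (qBinomial K (suc j))
      ≈⟨ shift-shift (suc n) (triExp n (suc j)) _ ⟨
    shift (suc n) (h (suc j)) ∎))

triExp-pascal : ∀ n l → l ≤ suc (n + n) → triExp n (suc l) + (suc (n + n) ∸ l) ≡ suc n + triExp n l
triExp-pascal n l l≤ = +-cancelʳ-≡ (suc l) _ _ (begin
  triExp n (suc l) + (suc (n + n) ∸ l) + suc l   ≡⟨ +-assoc (triExp n (suc l)) _ (suc l) ⟩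
  triExp n (suc l) + ((suc (n + n) ∸ l) + suc l) ≡⟨ cong (triExp n (suc l) +_)
                                                      (trans (+-suc _ l) (cong suc (m∸n+n≡m l≤))) ⟩
  triExp n (suc l) + suc (suc (n + n))           ≡⟨ lemma₁ (triExp n (suc l)) n ⟩
  triExp n (suc l) + suc n + suc n               ≡⟨ cong (_+ suc n) (triExp-suc n l) ⟨
  triExp n l + suc l + suc n                     ≡⟨ lemma₂ (triExp n l) (suc l) (suc n) ⟩
  suc n + triExp n l + suc l                     ∎)
  where
  open ≡-Reasoning
  lemma₁ : ∀ x n → x + suc (suc (n + n)) ≡ x + suc n + suc n
  lemma₁ = solve-∀
  lemma₂ : ∀ y a b → y + a + b ≡ b + y + a
  lemma₂ = solve-∀

tripleSum-sucʳ : ∀ n → tripleSum n (suc (suc (n + n))) ≗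
                       tripleSum n (suc (n + n)) ⊕ shift (suc n) (tripleSum n (suc (n + n)))
tripleSum-sucʳ n = begin
  tripleSum n (suc N)
    ≈⟨ sumS-sucˡ N _ ⟩
  shift (triExp n 0) oneS ⊕ sumS N (λ l → shift (triExp n (suc l)) (qBinomial (suc N) (suc l)))
    ≈⟨ ⊕-congˡ (shift (triExp n 0) oneS) (sumS-cong N pascal) ⟩
  shift (triExp n 0) oneS ⊕ sumS N (λ l → shift (suc n) (h l) ⊕ h (suc l))
    ≈⟨ ⊕-congˡ (shift (triExp n 0) oneS) (sumS-⊕ N (λ l → shift (suc n) (h l)) (λ l → h (suc l))) ⟩
  shift (triExp n 0) oneS ⊕ (sumS N (λ l → shift (suc n) (h l)) ⊕ sumS N (λ l → h (suc l)))
    ≈⟨ f⊕[g⊕h]≗[f⊕h]⊕g (shift (triExp n 0) oneS) _ _ ⟩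
  (shift (triExp n 0) oneS ⊕ sumS N (λ l → h (suc l))) ⊕ sumS N (λ l → shift (suc n) (h l))
    ≈⟨ ⊕-cong (⊕-congʳ (sumS N (λ l → h (suc l))) (shift-cong (triExp n 0) (qBinomial-zero N)))
              (shift-sumS (suc n) N h) ⟨
  (h 0 ⊕ sumS N (λ l → h (suc l))) ⊕ shift (suc n) (tripleSum n N)
    ≈⟨ ⊕-congʳ (shift (suc n) (tripleSum n N))
               (sumS-rotate N h (shift-zeroS (triExp n (suc N)) (qBinomial-> N (suc N) ≤-refl))) ⟨
  tripleSum n N ⊕ shift (suc n) (tripleSum n N) ∎
  where
  open ≗-Reasoning
  N = suc (n + n)
  h : ℕ → Series
  h l = shift (triExp n l) (qBinomial N l)
  pascal : ∀ l → l ≤ N → shift (triExp n (suc l)) (qBinomial (suc N) (suc l)) ≗ shift (suc n) (h l) ⊕ h (suc l)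
  pascal l l≤N = begin
    shift (triExp n (suc l)) (qBinomial (suc N) (suc l))
      ≈⟨ shift-cong (triExp n (suc l)) (qBinomial-pascal′ N l) ⟩
    shift (triExp n (suc l)) (shift (N ∸ l) (qBinomial N l) ⊕ qBinomial N (suc l))
      ≈⟨ shift-⊕ (triExp n (suc l)) _ _ ⟩
    shift (triExp n (suc l)) (shift (N ∸ l) (qBinomial N l)) ⊕ h (suc l)
      ≈⟨ ⊕-congʳ (h (suc l)) (shift-shift (triExp n (suc l)) (N ∸ l) _) ⟩
    shift (triExp n (suc l) + (N ∸ l)) (qBinomial N l) ⊕ h (suc l)
      ≈⟨ ⊕-congʳ (h (suc l)) (λ m → cong (λ u → shift u (qBinomial N l) m) (triExp-pascal n l l≤N)) ⟩
    shift (suc n + triExp n l) (qBinomial N l) ⊕ h (suc l)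
      ≈⟨ ⊕-congʳ (h (suc l)) (shift-shift (suc n) (triExp n l) _) ⟨
    shift (suc n) (h l) ⊕ h (suc l) ∎

gauss≤ : ∀ n → tripleSum n (suc (n + n)) ≗
               distinctPartitions≤ n ⊛ distinctPartitions≤ n ⊕ distinctPartitions≤ n ⊛ distinctPartitions≤ n
gauss≤ zero    m = cong₂ _+_ (sym (⊛-identityˡ oneS m)) (trans (qBinomial-diag 1 m) (sym (⊛-identityˡ oneS m)))
gauss≤ (suc n) = begin
  tripleSum (suc n) (suc (suc n + suc n))
    ≈⟨ (λ m → cong (λ N → tripleSum (suc n) N m) (cong (suc ∘ suc) (+-suc n n))) ⟩
  tripleSum (suc n) (suc (suc (suc (n + n))))
    ≈⟨ tripleSum-sucˡ n (suc (suc (n + n))) ⟩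
  T₊ ⊕ shift (suc n) T₊
    ≈⟨ ⊕-cong (tripleSum-sucʳ n) (shift-cong (suc n) (tripleSum-sucʳ n)) ⟩
  (T ⊕ shift (suc n) T) ⊕ shift (suc n) (T ⊕ shift (suc n) T)
    ≈⟨ ≗-trans (1+q^-⊛ (suc n) (X ⊛ T))
               (⊕-cong (1+q^-⊛ (suc n) T) (shift-cong (suc n) (1+q^-⊛ (suc n) T))) ⟨
  X ⊛ (X ⊛ T)
    ≈⟨ ⊛-congˡ X (⊛-congˡ X (gauss≤ n)) ⟩
  X ⊛ (X ⊛ (D ⊛ D ⊕ D ⊛ D))
    ≈⟨ ⊛-assoc X X (D ⊛ D ⊕ D ⊛ D) ⟨
  (X ⊛ X) ⊛ (D ⊛ D ⊕ D ⊛ D)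
    ≈⟨ ⊛-distribˡ (X ⊛ X) (D ⊛ D) (D ⊛ D) ⟩
  (X ⊛ X) ⊛ (D ⊛ D) ⊕ (X ⊛ X) ⊛ (D ⊛ D)
    ≈⟨ ⊕-cong square square ⟩
  (D ⊛ X) ⊛ (D ⊛ X) ⊕ (D ⊛ X) ⊛ (D ⊛ X) ∎
  where
  open ≗-Reasoning
  X = 1+q^ (suc n)
  D = distinctPartitions≤ n
  T = tripleSum n (suc (n + n))
  T₊ = tripleSum n (suc (suc (n + n)))
  square : (X ⊛ X) ⊛ (D ⊛ D) ≗ (D ⊛ X) ⊛ (D ⊛ X)
  square = ≗-trans (⊛-interchange X X D D) (⊛-cong (⊛-comm X D) (⊛-comm X D))

-- Gauss's identity

≤-tri : ∀ k → k ≤ tri k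
≤-tri zero    = z≤n
≤-tri (suc k) = s≤s (m≤m+n k (tri k))

n∸i≤triExp : ∀ n i → n ∸ i ≤ triExp n i
n∸i≤triExp zero    zero    = z≤n
n∸i≤triExp zero    (suc i) = z≤n
n∸i≤triExp (suc n) zero    = ≤-tri (suc n)
n∸i≤triExp (suc n) (suc i) = n∸i≤triExp n i

i∸n≤triExp : ∀ n i → i ∸ suc n ≤ triExp n i
i∸n≤triExp zero    zero    = z≤n
i∸n≤triExp zero    (suc i) = ≤-tri i
i∸n≤triExp (suc n) zero    = z≤n
i∸n≤triExp (suc n) (suc i) = i∸n≤triExp n i

triExp-≤ : ∀ n i → i ≤ n → triExp n i ≡ tri (n ∸ i)
triExp-≤ zero    zero    _         = refl
triExp-≤ (suc n) zero    _         = refl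
triExp-≤ (suc n) (suc i) (s≤s i≤n) = triExp-≤ n i i≤n

triExp-> : ∀ n r → triExp n (n + suc r) ≡ tri r
triExp-> zero    r = refl
triExp-> (suc n) r = triExp-> n r

triExp-bound₁ : ∀ n i k → triExp n i + k ≤ n → k ≤ i
triExp-bound₁ n i k ≤n with i ≤? n
... | yes i≤n = ≤-trans (m+n≤o⇒m≤o∸n k (≤-trans (≤-reflexive (+-comm k (n ∸ i)))
                         (≤-trans (+-monoˡ-≤ k (n∸i≤triExp n i)) ≤n)))
                        (≤-reflexive (m∸[m∸n]≡n i≤n))
... | no i≰n  = ≤-trans (m+n≤o⇒n≤o (triExp n i) ≤n) (<⇒≤ (≰⇒> i≰n))

triExp-bound₂ : ∀ n i k → triExp n i + k ≤ n → k + i ≤ suc (n + n)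
triExp-bound₂ n i k ≤n = begin
  k + i                         ≤⟨ +-monoʳ-≤ k (m≤n+m∸n i (suc n)) ⟩
  k + (suc n + (i ∸ suc n))     ≡⟨ lemma k (suc n) (i ∸ suc n) ⟩
  suc n + (i ∸ suc n + k)       ≤⟨ +-monoʳ-≤ (suc n) (≤-trans (+-monoˡ-≤ k (i∸n≤triExp n i)) ≤n) ⟩
  suc n + n                     ∎
  where
  open ≤-Reasoning
  lemma : ∀ a b c → a + (b + c) ≡ b + (c + a)
  lemma = solve-∀

tripleSum≗partitions : ∀ n → tripleSum n (suc (n + n)) ≗[≤ n ]
                             sumS (suc (n + n)) (λ i → shift (triExp n i) partitions)
tripleSum≗partitions n k k≤n = sumTo-cong (suc (n + n)) λ i _ →
  shift-cong-at (triExp n i) _ _ k λ { k′ refl →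
    trans (qBinomial-partitions≤ (suc (n + n)) i k′ (triExp-bound₂ n i k′ k≤n))
          (partitions≤≗partitions i k′ (triExp-bound₁ n i k′ k≤n)) }

triPoly : ℕ → Series
triPoly n = sumS (suc (n + n)) (λ i → shift (triExp n i) oneS)

sumS-shift≗triPoly⊛ : ∀ n f → sumS (suc (n + n)) (λ i → shift (triExp n i) f) ≗ triPoly n ⊛ f
sumS-shift≗triPoly⊛ n f = ≗-sym (≗-trans (sumS-⊛ (suc (n + n)) _ f) (sumS-cong (suc (n + n)) λ i _ →
  ≗-trans (shift-⊛ˡ (triExp n i) oneS f) (shift-cong (triExp n i) (⊛-identityˡ f))))

*-suc/2 : ∀ j → (j * suc j) / 2 ≡ tri j
*-suc/2 j = trans (cong (_/ 2) (twice j)) (m*n/n≡m (tri j) 2)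
  where
  twice : ∀ j → j * suc j ≡ tri j * 2
  twice zero    = refl
  twice (suc j) = trans (lemma j) (trans (cong (suc j * 2 +_) (twice j)) (sym (*-distribʳ-+ 2 (suc j) (tri j))))
    where
    lemma : ∀ j → suc j * suc (suc j) ≡ suc j * 2 + j * suc j
    lemma = solve-∀

sumTo-tri≡psiS : ∀ n k → k ≤ n → sumTo n (λ j → ind k (tri j)) ≡ psiS k
sumTo-tri≡psiS n k k≤n = begin
  sumTo n (λ j → ind k (tri j))
    ≡⟨ cong (λ u → sumTo u (λ j → ind k (tri j))) (m+[n∸m]≡n k≤n) ⟨
  sumTo (k + (n ∸ k)) (λ j → ind k (tri j))
    ≡⟨ sumTo-extend k (n ∸ k) _ (λ j k<j _ → ind-≢ k (tri j) (<⇒≢ (<-≤-trans k<j (≤-tri j)))) ⟩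
  sumTo k (λ j → ind k (tri j))
    ≡⟨ sumTo-cong k (λ j _ → trans (ind-sym k (tri j)) (cong (λ u → ind u k) (sym (*-suc/2 j)))) ⟩
  psiS k ∎
  where open ≡-Reasoning

triPoly≗psiS⊕psiS : ∀ n → triPoly n ≗[≤ n ] psiS ⊕ psiS
triPoly≗psiS⊕psiS n k k≤n = begin
  sumTo (suc (n + n)) (λ i → shift (triExp n i) oneS k)
    ≡⟨ sumTo-cong (suc (n + n)) (λ i _ → shift-oneS (triExp n i) k) ⟩
  sumTo (suc (n + n)) (λ i → ind k (triExp n i))
    ≡⟨ cong (λ u → sumTo u (λ i → ind k (triExp n i))) (+-suc n n) ⟨
  sumTo (n + suc n) (λ i → ind k (triExp n i))
    ≡⟨ sumTo-split n n _ ⟩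
  sumTo n (λ i → ind k (triExp n i)) + sumTo n (λ r → ind k (triExp n (n + suc r)))
    ≡⟨ cong₂ _+_ (sumTo-cong n (λ i i≤n → cong (ind k) (triExp-≤ n i i≤n)))
                 (sumTo-cong n (λ r _ → cong (ind k) (triExp-> n r))) ⟩
  sumTo n (λ i → ind k (tri (n ∸ i))) + sumTo n (λ r → ind k (tri r))
    ≡⟨ cong (_+ sumTo n (λ r → ind k (tri r))) (sumTo-reverse n (λ j → ind k (tri j))) ⟨
  sumTo n (λ j → ind k (tri j)) + sumTo n (λ r → ind k (tri r))
    ≡⟨ cong₂ _+_ (sumTo-tri≡psiS n k k≤n) (sumTo-tri≡psiS n k k≤n) ⟩
  psiS k + psiS k ∎
  where open ≡-Reasoning

+-double-injective : ∀ a b → a + a ≡ b + b → a ≡ b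
+-double-injective a b a+a≡b+b = *-cancelˡ-≡ a b 2
  (trans (cong (a +_) (+-identityʳ a)) (trans a+a≡b+b (cong (b +_) (sym (+-identityʳ b)))))

gauss : distinctPartitions ⊛ distinctPartitions ≗ psiS ⊛ partitions
gauss n = +-double-injective _ _ (begin
  (D ⊛ D) n + (D ⊛ D) n
    ≡⟨ cong₂ _+_ D≗Dₙ D≗Dₙ ⟩
  (Dₙ ⊛ Dₙ ⊕ Dₙ ⊛ Dₙ) n
    ≡⟨ gauss≤ n n ⟨
  tripleSum n (suc (n + n)) n
    ≡⟨ tripleSum≗partitions n n ≤-refl ⟩
  sumS (suc (n + n)) (λ i → shift (triExp n i) partitions) n
    ≡⟨ sumS-shift≗triPoly⊛ n partitions n ⟩
  (triPoly n ⊛ partitions) n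
    ≡⟨ ⊛-cong-≤ n {g = partitions} (triPoly≗psiS⊕psiS n) (λ _ _ → refl) n ≤-refl ⟩
  ((psiS ⊕ psiS) ⊛ partitions) n
    ≡⟨ ⊛-distribʳ partitions psiS psiS n ⟩
  (psiS ⊛ partitions) n + (psiS ⊛ partitions) n ∎)
  where
  open ≡-Reasoning
  D = distinctPartitions
  Dₙ = distinctPartitions≤ n
  D≗Dₙ : (D ⊛ D) n ≡ (Dₙ ⊛ Dₙ) n
  D≗Dₙ = sym (⊛-cong-≤ n (distinctPartitions≤≗distinctPartitions n)
                         (distinctPartitions≤≗distinctPartitions n) n ≤-refl)

⊛-cancelʳ : ∀ f {g h} → f 0 ≡ 1 → g ⊛ f ≗ h ⊛ f → g ≗ h
⊛-cancelʳ f {g} {h} f₀≡1 g⊛f≗h⊛f = ≗[≤]⇒≗ agree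
  where
  open ≡-Reasoning
  *f₀ : ∀ n a → a * f (n ∸ n) ≡ a
  *f₀ n a = trans (cong (a *_) (trans (cong f (n∸n≡0 n)) f₀≡1)) (*-identityʳ a)
  lower : Series → ℕ → ℕ
  lower u n = sumTo n (λ k → u k * f (suc n ∸ k))
  agree : ∀ n → g ≗[≤ n ] h
  agree zero    zero    _ = begin
    g 0           ≡⟨ *f₀ 0 (g 0) ⟨
    g 0 * f 0     ≡⟨ g⊛f≗h⊛f 0 ⟩
    h 0 * f 0     ≡⟨ *f₀ 0 (h 0) ⟩
    h 0           ∎
  agree (suc n) k k≤n+1 with m≤n⇒m<n∨m≡n k≤n+1
  ... | inj₁ k<n+1 = agree n k (≤-pred k<n+1)
  ... | inj₂ refl  = begin
    g (suc n)                  ≡⟨ *f₀ n (g (suc n)) ⟨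
    g (suc n) * f (n ∸ n)      ≡⟨ +-cancelˡ-≡ (lower h n) _ _ (begin
      lower h n + g (suc n) * f (n ∸ n)
        ≡⟨ cong (_+ g (suc n) * f (n ∸ n)) (sumTo-cong n λ k k≤n → cong (_* f (suc n ∸ k)) (agree n k k≤n)) ⟨
      lower g n + g (suc n) * f (n ∸ n)
        ≡⟨ g⊛f≗h⊛f (suc n) ⟩
      lower h n + h (suc n) * f (n ∸ n) ∎) ⟩
    h (suc n) * f (n ∸ n)      ≡⟨ *f₀ n (h (suc n)) ⟩
    h (suc n)                  ∎

-- Iterating P(q) = ψ(q) P(q²)²

partitions-factor : psiS ⊛ (subQ 2 partitions ⊛ subQ 2 partitions) ≗ partitions
partitions-factor = ≗-sym (⊛-cancelʳ partitions refl (begin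
  P ⊛ P                     ≈⟨ ⊛-cong euler euler ⟨
  (D ⊛ P₂) ⊛ (D ⊛ P₂)       ≈⟨ ⊛-interchange D P₂ D P₂ ⟩
  (D ⊛ D) ⊛ (P₂ ⊛ P₂)       ≈⟨ ⊛-congʳ (P₂ ⊛ P₂) gauss ⟩
  (psiS ⊛ P) ⊛ (P₂ ⊛ P₂)    ≈⟨ [f⊛g]⊛h≗[f⊛h]⊛g psiS P (P₂ ⊛ P₂) ⟩
  (psiS ⊛ (P₂ ⊛ P₂)) ⊛ P    ∎))
  where
  open ≗-Reasoning
  P = partitions
  P₂ = subQ 2 partitions
  D = distinctPartitions

subQ-partitions-factor : ∀ m .{{_ : NonZero m}} →
  subQ m psiS ⊛ subQ (2 * m) partitions ^ˢ 2 ≗ subQ m partitions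
subQ-partitions-factor (suc m) = begin
  subQ (suc m) psiS ⊛ (P₂ₘ ⊛ (P₂ₘ ⊛ oneS))
    ≈⟨ ⊛-congˡ (subQ (suc m) psiS) (⊛-congˡ P₂ₘ (⊛-identityʳ P₂ₘ)) ⟩
  subQ (suc m) psiS ⊛ (P₂ₘ ⊛ P₂ₘ)
    ≈⟨ ⊛-congˡ (subQ (suc m) psiS) (⊛-cong (subQ-subQ m 1 partitions) (subQ-subQ m 1 partitions)) ⟨
  subQ (suc m) psiS ⊛ (subQ (suc m) P₂ ⊛ subQ (suc m) P₂)
    ≈⟨ ⊛-congˡ (subQ (suc m) psiS) (subQ-⊛ m P₂ P₂) ⟨
  subQ (suc m) psiS ⊛ subQ (suc m) (P₂ ⊛ P₂)
    ≈⟨ subQ-⊛ m psiS (P₂ ⊛ P₂) ⟨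
  subQ (suc m) (psiS ⊛ (P₂ ⊛ P₂))
    ≈⟨ subQ-cong m partitions-factor ⟩
  subQ (suc m) partitions ∎
  where
  open ≗-Reasoning
  P₂ = subQ 2 partitions
  P₂ₘ = subQ (2 * suc m) partitions

psiFactor : ℕ → ℕ → Series
psiFactor e i = subQ (2 ^ i) psiS ^ˢ (e * 2 ^ (i ∸ 1))

psiFactor-telescope : ∀ e M →
  prodTo M (psiFactor e) ⊛ subQ (2 * 2 ^ M) partitions ^ˢ (e * 2 ^ M) ≗ subQ 2 partitions ^ˢ e
psiFactor-telescope e zero = ≗-trans (⊛-identityˡ _) (^ˢ-congʳ (subQ 2 partitions) (*-identityʳ e))
psiFactor-telescope e (suc M) = begin
  (prodTo M (psiFactor e) ⊛ psiFactor e (suc M)) ⊛ Y ^ˢ (e * (2 * 2 ^ M))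
    ≈⟨ ⊛-assoc (prodTo M (psiFactor e)) (ψₘ ^ˢ E) (Y ^ˢ (e * (2 * 2 ^ M))) ⟩
  prodTo M (psiFactor e) ⊛ (ψₘ ^ˢ E ⊛ Y ^ˢ (e * (2 * 2 ^ M)))
    ≈⟨ ⊛-congˡ (prodTo M (psiFactor e)) (⊛-congˡ (ψₘ ^ˢ E) (begin
         Y ^ˢ (e * (2 * 2 ^ M))    ≈⟨ ^ˢ-congʳ Y (double e (2 ^ M)) ⟩
         Y ^ˢ (E + E)              ≈⟨ ^ˢ-homo-⊛ Y E E ⟩
         Y ^ˢ E ⊛ Y ^ˢ E           ≈⟨ ^ˢ-distrib-⊛ Y Y E ⟨
         (Y ⊛ Y) ^ˢ E              ≈⟨ ^ˢ-congˡ E (⊛-congˡ Y (⊛-identityʳ Y)) ⟨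
         (Y ^ˢ 2) ^ˢ E             ∎)) ⟩
  prodTo M (psiFactor e) ⊛ (ψₘ ^ˢ E ⊛ (Y ^ˢ 2) ^ˢ E)
    ≈⟨ ⊛-congˡ (prodTo M (psiFactor e)) (^ˢ-distrib-⊛ ψₘ (Y ^ˢ 2) E) ⟨
  prodTo M (psiFactor e) ⊛ (ψₘ ⊛ Y ^ˢ 2) ^ˢ E
    ≈⟨ ⊛-congˡ (prodTo M (psiFactor e))
              (^ˢ-congˡ E (subQ-partitions-factor (2 ^ suc M) {{m^n≢0 2 (suc M)}})) ⟩
  prodTo M (psiFactor e) ⊛ subQ (2 * 2 ^ M) partitions ^ˢ E
    ≈⟨ psiFactor-telescope e M ⟩
  subQ 2 partitions ^ˢ e ∎
  where
  open ≗-Reasoning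
  E = e * 2 ^ M
  ψₘ = subQ (2 ^ suc M) psiS
  Y = subQ (2 * 2 ^ suc M) partitions
  double : ∀ a x → a * (2 * x) ≡ a * x + a * x
  double = solve-∀

n<2^n : ∀ n → n < 2 ^ n
n<2^n zero    = s≤s z≤n
n<2^n (suc n) = +-mono-≤ (m^n>0 2 n) (≤-trans (n<2^n n) (m≤m+n (2 ^ n) 0))

subQ2^-OneMod : ∀ n f e → f 0 ≡ 1 → OneMod (suc n) (subQ (2 ^ suc n) f ^ˢ e)
subQ2^-OneMod n f e f₀≡1 = OneMod-≤ (<⇒≤ (n<2^n (suc n)))
  (OneMod-^ˢ (2 ^ suc n) e (OneMod-subQ (2 ^ suc n) {{m^n≢0 2 (suc n)}} f f₀≡1))

psiProduct : ∀ e → infProd (λ i → powS (subQ (2 ^ i) psiS) (e * 2 ^ (i ∸ 1))) ≗ subQ 2 partitions ^ˢ e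
psiProduct e = ≗-trans (λ k → prodTo-cong k (λ i → powS≗^ˢ _ (e * 2 ^ i)) k) (≗[≤]⇒≗ truncated)
  where
  convergent : Convergent (psiFactor e)
  convergent i = subQ2^-OneMod i psiS (e * 2 ^ i) refl
  leftover≡1 : ∀ n → OneMod (suc n) (subQ (2 * 2 ^ n) partitions ^ˢ (e * 2 ^ n))
  leftover≡1 n = subQ2^-OneMod n partitions (e * 2 ^ n) refl
  truncated : ∀ n → infProd (psiFactor e) ≗[≤ n ] subQ 2 partitions ^ˢ e
  truncated n = ≗[≤]-trans n (≗[≤]-sym n (prodTo≗infProd n (psiFactor e) convergent))
    (≗[≤]-trans n (≗[≤]-sym n (⊛-OneMod n (prodTo n (psiFactor e)) (leftover≡1 n)))
                  (≗⇒≗[≤] n (psiFactor-telescope e n)))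

Fser-partitions : ∀ p′ → Fser (2 + p′) ≗ partitions ⊛ subQ 2 partitions ^ˢ p′
Fser-partitions p′ n = trans (truncated n n) (⊛-cong-≤ n (partitions≤≗partitions n)
  (^ˢ-cong-≤ p′ n (subQ-cong-≤ 1 n (partitions≤≗partitions n))) n ≤-refl)
  where
  truncated : ∀ N → prodTo N (λ j → subQ j geomS ⊛ powS (subQ (2 * j) geomS) p′) ≗
                    partitions≤ N ⊛ subQ 2 (partitions≤ N) ^ˢ p′
  truncated N = begin
    prodTo N (λ j → subQ j geomS ⊛ powS (subQ (2 * j) geomS) p′)
      ≈⟨ prodTo-⊛ N _ _ ⟩
    partitions≤ N ⊛ prodTo N (λ j → powS (subQ (2 * j) geomS) p′)
      ≈⟨ ⊛-congˡ (partitions≤ N) (prodTo-cong N (λ j → powS≗^ˢ _ p′)) ⟩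
    partitions≤ N ⊛ prodTo N (λ j → subQ (2 * j) geomS ^ˢ p′)
      ≈⟨ ⊛-congˡ (partitions≤ N) (prodTo-^ˢ N (λ j → subQ (2 * j) geomS) p′) ⟩
    partitions≤ N ⊛ prodTo N (λ j → subQ (2 * j) geomS) ^ˢ p′
      ≈⟨ ⊛-congˡ (partitions≤ N) (^ˢ-congˡ p′ (subQ2-partitions≤ N)) ⟨
    partitions≤ N ⊛ subQ 2 (partitions≤ N) ^ˢ p′ ∎
    where open ≗-Reasoning

Fser≗RHSser : ∀ p′ → Fser (2 + p′) ≗ RHSser (2 + p′)
Fser≗RHSser p′ = begin
  Fser (2 + p′)                     ≈⟨ Fser-partitions p′ ⟩
  partitions ⊛ P₂ ^ˢ p′             ≈⟨ ⊛-congʳ (P₂ ^ˢ p′) partitions-factor ⟨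
  psiS ⊛ (P₂ ⊛ P₂) ⊛ P₂ ^ˢ p′       ≈⟨ ⊛-assoc psiS (P₂ ⊛ P₂) (P₂ ^ˢ p′) ⟩
  psiS ⊛ ((P₂ ⊛ P₂) ⊛ P₂ ^ˢ p′)     ≈⟨ ⊛-congˡ psiS (⊛-assoc P₂ P₂ (P₂ ^ˢ p′)) ⟩
  psiS ⊛ P₂ ^ˢ (2 + p′)             ≈⟨ ⊛-congˡ psiS (psiProduct (2 + p′)) ⟨
  RHSser (2 + p′)                   ∎
  where
  open ≗-Reasoning
  P₂ = subQ 2 partitions

lemma2p1 : (p : ℕ) → Prime p → 3 ≤ p → (n : ℕ) → Fser p n ≡ RHSser p n
lemma2p1 (suc (suc p′)) _ _ = Fser≗RHSser p′
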